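{- Any streaming certification scheme for $\mathrm{Diameter}_{\leq 2}$ whose verifier uses $m$ bits of memory and whose certificates have $c$ bits satisfies $c+m=\Omega(n^2)$ on $n$-node graphs.
   Context: $\mathrm{Diameter}_{\leq 2}$ is the decision problem (with fixed threshold $2$) taking as input a graph $G$ and asking whether the diameter of $G$ is at most $2$. The $n$-node input graph on $[n]$ is given as a stream of edges in an arbitrary, possibly adversarial, order. A streaming certification scheme for a decision problem $P$ consists of a prover (a computationally unlimited function producing a certificate in $\{0,1\}^*$ depending only on the input graph, not on the edge order) and a verifier (a deterministic streaming algorithm with read-only access to the certificate that processes the stream and outputs accept or reject). Completeness: if $G$ satisfies $P$, some certificate makes the verifier accept for every edge order. Soundness: if $G$ does not satisfy $P$, the verifier rejects for every certificate and every edge order. $c$ is the certificate length and $m$ the verifier's memory excluding the certificate, as worst-case functions of $n$. -}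

module Defs where

open import Data.Nat using (ℕ; _≤_)
open import Data.Bool using (Bool; true; false)
open import Data.Fin using (Fin) renaming (_<_ to _<ᶠ_)
open import Data.Product using (_×_; _,_; ∃-syntax)
open import Data.Sum using (_⊎_)
open import Data.List using (List; length; foldl)
open import Data.List.Relation.Unary.All using (All)
open import Data.List.Relation.Unary.Unique.Propositional using (Unique)
open import Data.List.Membership.Propositional using (_∈_)
open import Data.Vec using (Vec)
open import Relation.Binary.PropositionalEquality using (_≡_; _≢_)
open import Relation.Nullary using (¬_)

record Graph (n : ℕ) : Set where
  field
    adj    : Fin n → Fin n → Bool
    sym    : ∀ u v → adj u v ≡ adj v u
    irrefl : ∀ u → adj u u ≡ false
open Graph public

Diam≤2 : ∀ {n} → Graph n → Set
Diam≤2 {n} G = ∀ (u v : Fin n) → u ≢ v →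
  (adj G u v ≡ true) ⊎ (∃[ w ] (adj G u w ≡ true × adj G w v ≡ true))

-- An edge {u,v} as it appears in the stream, written with u < v.
Edge : ℕ → Set
Edge n = Fin n × Fin n

IsEdgeOrder : ∀ {n} → Graph n → List (Edge n) → Set
IsEdgeOrder {n} G σ =
  All (λ e → (Data.Product.proj₁ e <ᶠ Data.Product.proj₂ e)
             × (adj G (Data.Product.proj₁ e) (Data.Product.proj₂ e) ≡ true)) σ
  × Unique σ
  × (∀ (u v : Fin n) → u <ᶠ v → adj G u v ≡ true → (u , v) ∈ σ)
  where import Data.Product

Cert : Set
Cert = List Bool

-- A streaming certification scheme for Diameter≤2 on n-node graphs with
-- certificate length c and verifier memory m bits (the memory content is a
-- Vec Bool m; the verifier has read-only access to the certificate at every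
-- step, and is otherwise an arbitrary deterministic function).
record Scheme (n c m : ℕ) : Set where
  field
    prover     : Graph n → Cert
    prover-len : ∀ G → length (prover G) ≤ c
    init       : Cert → Vec Bool m
    step       : Cert → Vec Bool m → Edge n → Vec Bool m
    decide     : Cert → Vec Bool m → Bool   -- true = accept

  run : Cert → List (Edge n) → Vec Bool m
  run w σ = foldl (step w) (init w) σ

  field
    complete : ∀ (G : Graph n) → Diam≤2 G → ∀ σ → IsEdgeOrder G σ →
               decide (prover G) (run (prover G) σ) ≡ true
    sound    : ∀ (G : Graph n) → ¬ Diam≤2 G → ∀ (w : Cert) σ → IsEdgeOrder G σ →
               decide w (run w σ) ≡ false

-- A fooling-set argument. Every t × t Boolean matrix M yields a graph of
-- diameter 2 whose edges split into "cross" edges, which encode M, and the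
-- remaining edges. If two matrices P, Q with P i j = false and Q i j = true
-- received the same certificate and left the verifier in the same memory
-- state after their cross edges, the verifier would also accept the cross
-- edges of P followed by the remaining edges of Q; but that is a stream of a
-- graph in which the vertices encoding row i and column j are at distance 3.
-- Hence M ↦ (certificate, memory) is injective, so t² ≤ 2c + m, and the
-- gadget fits into n vertices for t ≈ n / 3.
module Submission where

open import Defs hiding (sym)
open import Data.Nat using (ℕ; zero; suc; _+_; _*_; _^_; _≤_; z≤n; s≤s)
open import Data.Nat.Properties
  using (≮⇒≥; <⇒≱; ^-monoʳ-<; m≤m+n; +-monoʳ-≤; *-mono-≤; *-monoʳ-≤; module ≤-Reasoning)
open import Data.Nat.Tactic.RingSolver using (solve-∀)
open import Data.Bool using (Bool; true; false; _∧_; _∨_; not; T; if_then_else_)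
open import Data.Bool.Properties using (T?; T-≡; T-∧; ∨-comm)
open import Data.Fin as Fin using (Fin; _↑ˡ_; _↑ʳ_; splitAt; combine; remQuot) renaming (_<_ to _<ᶠ_)
open import Data.Fin.Properties using (_≟_; _<?_; 2↔Bool; injective⇒≤; splitAt-↑ˡ; splitAt-↑ʳ; combine-remQuot)
open import Data.Product using (_×_; _,_; proj₁; proj₂; ∃-syntax; uncurry)
open import Data.Sum using (_⊎_; inj₁; inj₂; [_,_])
open import Data.Empty using (⊥; ⊥-elim)
open import Data.List using (List; []; _∷_; length; foldl; filter; cartesianProduct; allFin)
  renaming (_++_ to _++ₗ_)
open import Data.List.Properties using (foldl-++; filter-≐)
open import Data.List.Relation.Unary.All as All using (All)
import Data.List.Relation.Unary.All.Properties as All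
open import Data.List.Relation.Unary.Unique.Propositional using (Unique)
import Data.List.Relation.Unary.Unique.Propositional.Properties as Unique
open import Data.List.Membership.Propositional using (_∈_)
open import Data.List.Membership.Propositional.Properties
  using (∈-filter⁺; ∈-filter⁻; ∈-cartesianProduct⁺; ∈-allFin; ∈-++⁺ˡ; ∈-++⁺ʳ)
open import Data.Vec using (Vec; []; _∷_; _++_; lookup; tabulate)
open import Data.Vec.Properties using (∷-injective; ∷-injectiveʳ; ++-injective; tabulate∘lookup; tabulate-cong)
open import Data.Vec.Recursive using (Fin[m^n]↔Fin[m]^n; lift↔)
open import Data.Vec.Recursive.Properties using (↔Vec)
open import Function using (_∘_; id; case_of_; _↔_; _↣_; mk↣; Injection; Equivalence)
open import Function.Definitions using (Injective)
open import Function.Properties.Inverse using (↔-sym; ↔-trans; ↔⇒↣)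
open import Function.Construct.Composition using (_↣-∘_)
open import Relation.Binary.PropositionalEquality
  using (_≡_; _≢_; refl; sym; trans; cong; cong₂; subst; subst₂; module ≡-Reasoning)
open import Relation.Nullary using (¬_; Dec; does; yes; no; contradiction)
open import Relation.Nullary.Decidable using (dec-true)

Vec-Bool↔Fin : ∀ p → Vec Bool p ↔ Fin (2 ^ p)
Vec-Bool↔Fin p = ↔-sym (↔-trans (Fin[m^n]↔Fin[m]^n 2 p) (↔-trans (lift↔ p 2↔Bool) (↔Vec p)))

↣⇒length≤ : ∀ {p q} → Vec Bool p ↣ Vec Bool q → p ≤ q
↣⇒length≤ {p} {q} f =
  ≮⇒≥ λ q<p → <⇒≱ (^-monoʳ-< 2 (s≤s (s≤s z≤n)) q<p) (injective⇒≤ (Injection.injective g))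
  where
  g : Fin (2 ^ p) ↣ Fin (2 ^ q)
  g = ↔⇒↣ (Vec-Bool↔Fin q) ↣-∘ (f ↣-∘ ↔⇒↣ (↔-sym (Vec-Bool↔Fin p)))

padded : ∀ c → List Bool → Vec Bool (c * 2)
padded zero    _        = []
padded (suc c) []       = false ∷ false ∷ padded c []
padded (suc c) (x ∷ xs) = true ∷ x ∷ padded c xs

padded-injective : ∀ c {xs ys : List Bool} → length xs ≤ c → length ys ≤ c →
                   padded c xs ≡ padded c ys → xs ≡ ys
padded-injective zero    {[]}     {[]}     _        _         _  = refl
padded-injective (suc c) {[]}     {[]}     _        _         _  = refl
padded-injective (suc c) {x ∷ xs} {y ∷ ys} (s≤s ≤c) (s≤s ≤c′) eq
  with refl , eq′ ← ∷-injective (∷-injectiveʳ eq) = cong (x ∷_) (padded-injective c ≤c ≤c′ eq′)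

Matrix : ℕ → Set
Matrix t = Fin t → Fin t → Bool

toMatrix : ∀ {t} → Vec Bool (t * t) → Matrix t
toMatrix v i j = lookup v (combine i j)

toMatrix-injective : ∀ {t} {v w : Vec Bool (t * t)} →
                     (∀ i j → toMatrix v i j ≡ toMatrix w i j) → v ≡ w
toMatrix-injective {t} {v} {w} eq = begin
  v                   ≡⟨ sym (tabulate∘lookup v) ⟩
  tabulate (lookup v) ≡⟨ tabulate-cong lookup-eq ⟩
  tabulate (lookup w) ≡⟨ tabulate∘lookup w ⟩
  w                   ∎
  where
  open ≡-Reasoning
  lookup-eq : ∀ k → lookup v k ≡ lookup w k
  lookup-eq k =
    subst (λ k → lookup v k ≡ lookup w k) (combine-remQuot {t} t k) (uncurry eq (remQuot {t} t k))

module _ {n : ℕ} where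

  ordered? : (e : Edge n) → Dec (proj₁ e <ᶠ proj₂ e)
  ordered? e = proj₁ e <? proj₂ e

  pairs : List (Edge n)
  pairs = filter ordered? (cartesianProduct (allFin n) (allFin n))

  edgesWhere : (Edge n → Bool) → List (Edge n)
  edgesWhere f = filter (T? ∘ f) pairs

  edgesWhere-cong : ∀ {f g : Edge n → Bool} → (∀ e → f e ≡ g e) → edgesWhere f ≡ edgesWhere g
  edgesWhere-cong f≗g =
    filter-≐ (T? ∘ _) (T? ∘ _) ((λ {e} → subst T (f≗g e)) , (λ {e} → subst T (sym (f≗g e)))) pairs

  ∈-edgesWhere⁻ : ∀ {f e} → e ∈ edgesWhere f → proj₁ e <ᶠ proj₂ e × T (f e)
  ∈-edgesWhere⁻ {f} e∈ with e∈pairs , fe ← ∈-filter⁻ (T? ∘ f) {xs = pairs} e∈ =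
      proj₂ (∈-filter⁻ ordered? {xs = cartesianProduct (allFin n) (allFin n)} e∈pairs)
    , fe

  ∈-edgesWhere⁺ : ∀ {f u v} → u <ᶠ v → T (f (u , v)) → (u , v) ∈ edgesWhere f
  ∈-edgesWhere⁺ {f} {u} {v} u<v fe = ∈-filter⁺ (T? ∘ f) uv∈pairs fe
    where
    uv∈pairs : (u , v) ∈ pairs
    uv∈pairs = ∈-filter⁺ ordered? (∈-cartesianProduct⁺ (∈-allFin u) (∈-allFin v)) u<v

  edgesWhere-unique : ∀ f → Unique (edgesWhere f)
  edgesWhere-unique f = Unique.filter⁺ (T? ∘ f) (Unique.filter⁺ ordered?
                          (Unique.cartesianProduct⁺ (Unique.allFin⁺ n) (Unique.allFin⁺ n)))

  module _ (G : Graph n) (isA : Edge n → Bool) where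

    edgesA edgesB : List (Edge n)
    edgesA = edgesWhere (λ e → isA e ∧ adj G (proj₁ e) (proj₂ e))
    edgesB = edgesWhere (λ e → not (isA e) ∧ adj G (proj₁ e) (proj₂ e))

    split-isEdgeOrder : IsEdgeOrder G (edgesA ++ₗ edgesB)
    split-isEdgeOrder = All.++⁺ (edges-of-G id) (edges-of-G not)
                      , Unique.++⁺ (edgesWhere-unique _) (edgesWhere-unique _) disjoint
                      , covers
      where
      edges-of-G : ∀ (side : Bool → Bool) →
        All (λ e → proj₁ e <ᶠ proj₂ e × adj G (proj₁ e) (proj₂ e) ≡ true)
            (edgesWhere (λ e → side (isA e) ∧ adj G (proj₁ e) (proj₂ e)))
      edges-of-G side = All.tabulate λ e∈ →
        let u<v , fe = ∈-edgesWhere⁻ e∈ in u<v , Equivalence.to T-≡ (proj₂ (Equivalence.to T-∧ fe))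

      disjoint : ∀ {e} → ¬ (e ∈ edgesA × e ∈ edgesB)
      disjoint {e} (e∈A , e∈B) with isA e | proj₂ (∈-edgesWhere⁻ e∈A) | proj₂ (∈-edgesWhere⁻ e∈B)
      ... | true  | _  | ()
      ... | false | () | _

      covers : ∀ u v → u <ᶠ v → adj G u v ≡ true → (u , v) ∈ (edgesA ++ₗ edgesB)
      covers u v u<v uv with isA (u , v) in side
      ... | true  = ∈-++⁺ˡ (∈-edgesWhere⁺ u<v (subst T (sym (cong₂ _∧_ side uv)) _))
      ... | false = ∈-++⁺ʳ edgesA (∈-edgesWhere⁺ u<v (subst T (sym (cong₂ _∧_ (cong not side) uv)) _))

module _ {n c m} (S : Scheme n c m) where
  open Scheme S

  cut-and-paste : ∀ {G H : Graph n} {σ σ′ τ} →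
    Diam≤2 G → IsEdgeOrder G (σ ++ₗ τ) → ¬ Diam≤2 H → IsEdgeOrder H (σ′ ++ₗ τ) →
    run (prover G) σ′ ≢ run (prover G) σ
  cut-and-paste {G} {H} {σ} {σ′} {τ} yes-G stream-G no-H stream-H same = contradiction (begin
    true                                      ≡⟨ sym (complete G yes-G _ stream-G) ⟩
    decide w (run w (σ ++ₗ τ))                ≡⟨ cong (decide w) (foldl-++ (step w) (init w) σ τ) ⟩
    decide w (foldl (step w) (run w σ) τ)     ≡⟨ cong (λ s → decide w (foldl (step w) s τ)) (sym same) ⟩
    decide w (foldl (step w) (run w σ′) τ)    ≡⟨ cong (decide w) (sym (foldl-++ (step w) (init w) σ′ τ)) ⟩
    decide w (run w (σ′ ++ₗ τ))               ≡⟨ sound H no-H w _ stream-H ⟩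
    false                                     ∎) λ ()
    where
    open ≡-Reasoning
    w : Cert
    w = prover G

data Role (t : ℕ) : Set where
  row twin column : Fin t → Role t
  hub₁ hub₂       : Role t

gadgetSize : ℕ → ℕ → ℕ
gadgetSize t r = t + (t + (t + suc (suc r)))

module _ {t : ℕ} where

  hubRole : ∀ {r} → Fin (suc (suc r)) → Role t
  hubRole Fin.zero    = hub₂
  hubRole (Fin.suc _) = hub₁

  -- Vertices beyond the first 3t + 2 all play the role of hub₁.
  role : ∀ {r} → Fin (gadgetSize t r) → Role t
  role = [ row , [ twin , [ column , hubRole ] ∘ splitAt t ] ∘ splitAt t ] ∘ splitAt t

  vertex : ∀ {r} → Role t → Fin (gadgetSize t r)
  vertex (row i)    = i ↑ˡ _
  vertex (twin i)   = t ↑ʳ (i ↑ˡ _)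
  vertex (column j) = t ↑ʳ (t ↑ʳ (j ↑ˡ _))
  vertex hub₂       = t ↑ʳ (t ↑ʳ (t ↑ʳ Fin.zero))
  vertex hub₁       = t ↑ʳ (t ↑ʳ (t ↑ʳ Fin.suc Fin.zero))

  role-vertex : ∀ {r} (q : Role t) → role {r} (vertex q) ≡ q
  role-vertex (row i)    = cong [ row , _ ] (splitAt-↑ˡ t i _)
  role-vertex (twin i)   = trans (cong [ row , _ ] (splitAt-↑ʳ t _ _))
                                 (cong [ twin , _ ] (splitAt-↑ˡ t i _))
  role-vertex (column j) = trans (cong [ row , _ ] (splitAt-↑ʳ t _ _))
                         (trans (cong [ twin , _ ] (splitAt-↑ʳ t _ _))
                                (cong [ column , _ ] (splitAt-↑ˡ t j _)))
  role-vertex hub₂       = trans (cong [ row , _ ] (splitAt-↑ʳ t _ _))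
                         (trans (cong [ twin , _ ] (splitAt-↑ʳ t _ _))
                                (cong [ column , hubRole ] (splitAt-↑ʳ t _ _)))
  role-vertex hub₁       = trans (cong [ row , _ ] (splitAt-↑ʳ t _ _))
                         (trans (cong [ twin , _ ] (splitAt-↑ʳ t _ _))
                                (cong [ column , hubRole ] (splitAt-↑ʳ t _ _)))

  vertex-injective : ∀ {r} {q s : Role t} → vertex {r} q ≡ vertex s → q ≡ s
  vertex-injective {q = q} {s} eq = trans (sym (role-vertex q)) (trans (cong role eq) (role-vertex s))

  isRow isColumn : Role t → Bool
  isRow (row _) = true
  isRow _       = false
  isColumn (column _) = true
  isColumn _          = false

  cross : Role t → Role t → Bool
  cross q s = isRow q ∧ isColumn s ∨ isRow s ∧ isColumn q

  arc : Matrix t → Role t → Role t → Bool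
  arc M (row i)  (column j) = M i j
  arc M (row i)  (twin i′)  = does (i ≟ i′)
  arc M (twin i) (column j) = not (M i j)
  arc M hub₁     (row _)    = true
  arc M hub₁     (twin _)   = true
  arc M hub₁     hub₂       = true
  arc M hub₂     (twin _)   = true
  arc M hub₂     (column _) = true
  arc M _        _          = false

  edge : Matrix t → Role t → Role t → Bool
  edge M q s = arc M q s ∨ arc M s q

  mixedEdge : Matrix t → Matrix t → Role t → Role t → Bool
  mixedEdge P Q q s = if cross q s then edge P q s else edge Q q s

  mixedEdge-sym : ∀ P Q q s → mixedEdge P Q q s ≡ mixedEdge P Q s q
  mixedEdge-sym P Q q s
    rewrite ∨-comm (isRow q ∧ isColumn s) (isRow s ∧ isColumn q)
          | ∨-comm (arc P q s) (arc P s q) | ∨-comm (arc Q q s) (arc Q s q) = refl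

  mixedEdge-irrefl : ∀ P Q q → mixedEdge P Q q q ≡ false
  mixedEdge-irrefl P Q (row _)    = refl
  mixedEdge-irrefl P Q (twin _)   = refl
  mixedEdge-irrefl P Q (column _) = refl
  mixedEdge-irrefl P Q hub₁       = refl
  mixedEdge-irrefl P Q hub₂       = refl

  Within2 : Matrix t → Role t → Role t → Set
  Within2 M q s =
    mixedEdge M M q s ≡ true ⊎ ∃[ p ] (mixedEdge M M q p ≡ true × mixedEdge M M p s ≡ true)

  pattern direct = inj₁ refl
  pattern via p  = inj₂ (p , refl , refl)

  within2-row-column : ∀ M i j → Within2 M (row i) (column j)
  within2-row-column M i j with M i j in Mij
  ... | true  = direct
  ... | false =
    inj₂ (twin i , cong (_∨ false) (dec-true (i ≟ i) refl) , cong (λ x → not x ∨ false) Mij)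

  within2-swap : ∀ M q s → Within2 M q s → Within2 M s q
  within2-swap M q s (inj₁ e)            = inj₁ (trans (mixedEdge-sym M M s q) e)
  within2-swap M q s (inj₂ (p , e , e′)) =
    inj₂ (p , trans (mixedEdge-sym M M s p) e′ , trans (mixedEdge-sym M M p q) e)

  within2 : ∀ M q s → Within2 M q s
  within2 M (row i)    (row _)    = via hub₁
  within2 M (row i)    (twin _)   = via hub₁
  within2 M (row i)    (column j) = within2-row-column M i j
  within2 M (row i)    hub₁       = direct
  within2 M (row i)    hub₂       = via hub₁
  within2 M (twin i)   (row _)    = via hub₁
  within2 M (twin i)   (twin _)   = via hub₁
  within2 M (twin i)   (column _) = via hub₂
  within2 M (twin i)   hub₁       = direct
  within2 M (twin i)   hub₂       = direct
  within2 M (column j) (row i)    = within2-swap M (row i) (column j) (within2-row-column M i j)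
  within2 M (column j) (twin _)   = via hub₂
  within2 M (column j) (column _) = via hub₂
  within2 M (column j) hub₁       = via hub₂
  within2 M (column j) hub₂       = direct
  within2 M hub₁       (row _)    = direct
  within2 M hub₁       (twin _)   = direct
  within2 M hub₁       (column _) = via hub₂
  within2 M hub₁       hub₁       = via hub₂
  within2 M hub₁       hub₂       = direct
  within2 M hub₂       (row _)    = via hub₁
  within2 M hub₂       (twin _)   = direct
  within2 M hub₂       (column _) = direct
  within2 M hub₂       hub₁       = direct
  within2 M hub₂       hub₂       = via hub₁

  no-common-neighbour : ∀ P Q {i j} → Q i j ≡ true →
    ∀ p → mixedEdge P Q (row i) p ≡ true → mixedEdge P Q p (column j) ≡ true → ⊥
  no-common-neighbour P Q {i} Qij (twin i′) ri~p p~cj with i ≟ i′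
  no-common-neighbour P Q Qij (twin _)   ri~p p~cj | yes refl rewrite Qij with () ← p~cj
  no-common-neighbour P Q Qij (twin _)   ()   p~cj | no _
  no-common-neighbour P Q Qij (row _)    ()   p~cj
  no-common-neighbour P Q Qij (column _) ri~p ()
  no-common-neighbour P Q Qij hub₁       ri~p ()
  no-common-neighbour P Q Qij hub₂       ()   p~cj

module _ {t r : ℕ} where

  gadget : Matrix t → Matrix t → Graph (gadgetSize t r)
  gadget P Q = record
    { adj    = λ u v → mixedEdge P Q (role u) (role v)
    ; sym    = λ u v → mixedEdge-sym P Q (role u) (role v)
    ; irrefl = λ u → mixedEdge-irrefl P Q (role u)
    }

  gadget-diam≤2 : ∀ M → Diam≤2 (gadget M M)
  gadget-diam≤2 M u v _ with within2 M (role u) (role v)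
  ... | inj₁ e            = inj₁ e
  ... | inj₂ (p , e , e′) = inj₂ (vertex p
                                 , subst (λ x → mixedEdge M M (role u) x ≡ true) (sym (role-vertex p)) e
                                 , subst (λ x → mixedEdge M M x (role v) ≡ true) (sym (role-vertex p)) e′)

  gadget-not-diam≤2 : ∀ {P Q i j} → P i j ≡ false → Q i j ≡ true → ¬ Diam≤2 (gadget P Q)
  gadget-not-diam≤2 {P} {Q} {i} {j} Pij Qij diam
    with diam (vertex (row i)) (vertex (column j)) (λ eq → case vertex-injective {q = row i} {s = column j} eq of λ ())
  ... | inj₁ e
    with () ← trans (sym (cong (_∨ false) Pij))
                (subst₂ (λ x y → mixedEdge P Q x y ≡ true) (role-vertex (row i)) (role-vertex (column j)) e)
  ... | inj₂ (w , e , e′) = no-common-neighbour P Q Qij (role w)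
                              (subst (λ x → mixedEdge P Q x (role w) ≡ true) (role-vertex (row i)) e)
                              (subst (λ y → mixedEdge P Q (role w) y ≡ true) (role-vertex (column j)) e′)

  isCross : Edge (gadgetSize t r) → Bool
  isCross e = cross {t} (role (proj₁ e)) (role (proj₂ e))

  crossEdges otherEdges : Matrix t → List (Edge (gadgetSize t r))
  crossEdges P = edgesWhere (λ e → isCross e ∧ edge P (role (proj₁ e)) (role (proj₂ e)))
  otherEdges Q = edgesWhere (λ e → not (isCross e) ∧ edge Q (role (proj₁ e)) (role (proj₂ e)))

  gadget-isEdgeOrder : ∀ P Q → IsEdgeOrder (gadget P Q) (crossEdges P ++ₗ otherEdges Q)
  gadget-isEdgeOrder P Q = subst (IsEdgeOrder (gadget P Q))
    (cong₂ _++ₗ_ (edgesWhere-cong (λ e → ∧-if-then (isCross e)))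
                 (edgesWhere-cong (λ e → not-∧-if-else (isCross e))))
    (split-isEdgeOrder (gadget P Q) isCross)
    where
    ∧-if-then : ∀ x {y z : Bool} → x ∧ (if x then y else z) ≡ x ∧ y
    ∧-if-then true  = refl
    ∧-if-then false = refl
    not-∧-if-else : ∀ x {y z : Bool} → not x ∧ (if x then y else z) ≡ not x ∧ z
    not-∧-if-else true  = refl
    not-∧-if-else false = refl

module _ {t r c m} (S : Scheme (gadgetSize t r) c m) where
  open Scheme S

  certificate : Matrix t → Cert
  certificate M = prover (gadget M M)

  stateAfterCross : Matrix t → Vec Bool m
  stateAfterCross M = run (certificate M) (crossEdges M)

  distinguishes : ∀ {P Q i j} → P i j ≡ false → Q i j ≡ true →
    certificate P ≡ certificate Q → stateAfterCross P ≢ stateAfterCross Q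
  distinguishes {P} {Q} Pij Qij same-cert same-state =
    cut-and-paste S {gadget Q Q} {gadget P Q} {crossEdges Q} {crossEdges P} {otherEdges Q}
                    (gadget-diam≤2 Q) (gadget-isEdgeOrder Q Q)
                    (gadget-not-diam≤2 {P = P} {Q} Pij Qij) (gadget-isEdgeOrder P Q)
                    (subst (λ w → run w (crossEdges P) ≡ stateAfterCross Q) same-cert same-state)

  fingerprint-injective : ∀ {P Q} → certificate P ≡ certificate Q →
    stateAfterCross P ≡ stateAfterCross Q → ∀ i j → P i j ≡ Q i j
  fingerprint-injective {P} {Q} same-cert same-state i j with P i j in Pij | Q i j in Qij
  ... | true  | true  = refl
  ... | false | false = refl
  ... | false | true  = ⊥-elim (distinguishes Pij Qij same-cert same-state)
  ... | true  | false = ⊥-elim (distinguishes Qij Pij (sym same-cert) (sym same-state))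

  side²≤ : t * t ≤ c * 2 + m
  side²≤ = ↣⇒length≤ (mk↣ {to = fingerprint} injective)
    where
    fingerprint : Vec Bool (t * t) → Vec Bool (c * 2 + m)
    fingerprint v = padded c (certificate (toMatrix v)) ++ stateAfterCross (toMatrix v)
    injective : Injective _≡_ _≡_ fingerprint
    injective {v} {w} eq with same-cert , same-state ← ++-injective (padded c _) (padded c _) eq =
      toMatrix-injective (fingerprint-injective
        (padded-injective c (prover-len _) (prover-len _) same-cert) same-state)

thirds : ∀ k → ∃[ t ] ∃[ r ] (r ≤ 2 × k ≡ t + (t + (t + r)))
thirds 0 = 0 , 0 , z≤n , refl
thirds 1 = 0 , 1 , s≤s z≤n , refl
thirds 2 = 0 , 2 , s≤s (s≤s z≤n) , refl
thirds (suc (suc (suc k))) with t , r , r≤2 , refl ← thirds k = suc t , r , r≤2 , shift t r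
  where
  shift : ∀ t r → 3 + (t + (t + (t + r))) ≡ suc t + (suc t + (suc t + r))
  shift = solve-∀

gadget-fits : ∀ n → 5 ≤ n → ∃[ t ] ∃[ r ] (n ≡ gadgetSize t r × n ≤ 7 * t)
gadget-fits _ (s≤s (s≤s (s≤s (s≤s (s≤s {n = k} _))))) with t , r , r≤2 , refl ← thirds k =
  suc t , r , size t r , (begin
    5 + (t + (t + (t + r)))              ≤⟨ +-monoʳ-≤ 5 (+-monoʳ-≤ t (+-monoʳ-≤ t (+-monoʳ-≤ t r≤2))) ⟩
    5 + (t + (t + (t + 2)))              ≤⟨ m≤m+n _ (4 * t) ⟩
    5 + (t + (t + (t + 2))) + 4 * t      ≡⟨ seven t ⟩
    7 * suc t                            ∎)
  where
  open ≤-Reasoning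
  size : ∀ t r → 5 + (t + (t + (t + r))) ≡ suc t + (suc t + (suc t + suc (suc r)))
  size = solve-∀
  seven : ∀ t → 5 + (t + (t + (t + 2))) + 4 * t ≡ 7 * suc t
  seven = solve-∀

theorem17 : (c m : ℕ → ℕ) → (S : (n : ℕ) → Scheme n (c n) (m n)) →
    ∃[ k ] ∃[ N ] (∀ (n : ℕ) → N ≤ n → n * n ≤ k * (c n + m n))
theorem17 c m S = 98 , 5 , bound
  where
  bound : ∀ n → 5 ≤ n → n * n ≤ 98 * (c n + m n)
  bound n 5≤n with t , r , refl , n≤7t ← gadget-fits n 5≤n = begin
    n * n                           ≤⟨ *-mono-≤ n≤7t n≤7t ⟩
    7 * t * (7 * t)                 ≡⟨ square t ⟩
    49 * (t * t)                    ≤⟨ *-monoʳ-≤ 49 (side²≤ {t} {r} (S n)) ⟩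
    49 * (c n * 2 + m n)            ≤⟨ m≤m+n _ (49 * m n) ⟩
    49 * (c n * 2 + m n) + 49 * m n ≡⟨ double (c n) (m n) ⟩
    98 * (c n + m n)                ∎
    where
    open ≤-Reasoning
    square : ∀ t → 7 * t * (7 * t) ≡ 49 * (t * t)
    square = solve-∀
    double : ∀ x y → 49 * (x * 2 + y) + 49 * y ≡ 98 * (x + y)
    double = solve-∀
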